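{- Let $\mathcal F$ be an algebraic language with no nullary symbols, $\mathbf I=([m];\mathcal F)$ a finite $\mathcal F$-algebra, $\mathbf A$ an $\mathcal F$-algebra with a surjective homomorphism $\chi\colon\mathbf A\to\mathbf I$, $\mathbf C:=\mathfrak C(\mathbf A,\chi)$, $\alpha:=\ker\chi$. (1) For every $n\ge1$, the map $B\mapsto B^*:=\{(\mathbf a_1,\dots,\mathbf a_n)\in C^n:(a_1^{(i)},\dots,a_n^{(i)})\in B\text{ for all }i\in[m]\}$ is a lattice isomorphism from the lattice of $n$-ary reflexive compatible relations of $\mathbf A$ contained in $A^n[\alpha]$ onto the lattice of $n$-ary reflexive compatible relations of $\mathbf C$. (2) Over all arities, this map preserves intersections of relations of the same arity, relational composition, and coordinate manipulations (permutation, identification and duplication of coordinates, projection to subsets of coordinates); moreover, for reflexive compatible $R\subseteq A^k[\alpha]$ and $S\subseteq A^n[\alpha]$, $(R\times_\alpha S)^*=R^*\times S^*$, where $R\times_\alpha S:=(R\times S)\cap A^{k+n}[\alpha]$.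
   Context: $[m]=\{1,\dots,m\}$; $A^n[\alpha]=\{(a_1,\dots,a_n)\in A^n:a_j\,\alpha\,a_l\ \forall j,l\}$. A compatible relation is a subuniverse of a power; it is reflexive if it contains all constant tuples. With $D^{(i)}=\chi^{ -1}(i)$, $\mathfrak C(\mathbf A,\chi)$ has universe $C=D^{(1)}\times\dots\times D^{(m)}$ (columns $\mathbf c=(c^{(1)},\dots,c^{(m)})$), an $m$-ary operation $d(\mathbf c_1,\dots,\mathbf c_m)=(c_1^{(1)},\dots,c_m^{(m)})$, and for each $k$-ary $f\in\mathcal F$ and $\mathbf i\in[m]^k$ a $k$-ary operation $\hat f_{\mathbf i}(\mathbf c_1,\dots,\mathbf c_k)$: $\mathbf c_1$ with its $f^{\mathbf I}(\mathbf i)$-th entry replaced by $f^{\mathbf A}(c_1^{(i_1)},\dots,c_k^{(i_k)})$. -}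

module Defs where

open import Level using (0ℓ)
open import Data.Nat using (ℕ; _+_; _≤_)
open import Data.Fin using (Fin; fromℕ<)
open import Data.Fin.Patterns using (0F; 1F)
open import Data.Vec using (Vec; []; _∷_; lookup; tabulate; map; replicate; take; drop; _[_]≔_)
open import Data.Product using (Σ; ∃; _×_; _,_)
open import Data.Sum using (_⊎_; inj₁; inj₂)
open import Data.Unit using (⊤)
open import Relation.Binary.PropositionalEquality using (_≡_)
open import Relation.Unary using (Pred; _⊆_; _≐_; _∩_; _∪_)

-- Algebraic languages and algebras (tuples are vectors, so that
-- equality of tuples is propositional equality without funext).

record Signature : Set₁ where
  field
    Op    : Set
    arity : Op → ℕ
open Signature public

NoNullary : Signature → Set
NoNullary F = ∀ (f : Op F) → 1 ≤ arity F f

record Algebra (F : Signature) : Set₁ where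
  field
    Carrier : Set
    ⟦_⟧     : (f : Op F) → Vec Carrier (arity F f) → Carrier
open Algebra public

FinAlgebraOps : Signature → ℕ → Set
FinAlgebraOps F m = (f : Op F) → Vec (Fin m) (arity F f) → Fin m

IsHom : ∀ {F} {m} (I : FinAlgebraOps F m) (A : Algebra F) → (Carrier A → Fin m) → Set
IsHom {F} I A χ = ∀ (f : Op F) (as : Vec (Carrier A) (arity F f)) →
  χ (⟦ A ⟧ f as) ≡ I f (map χ as)

IsSurjective : {X Y : Set} → (X → Y) → Set
IsSurjective {X} {Y} g = ∀ (y : Y) → ∃ λ (x : X) → g x ≡ y

-- Basic operations of an algebra with universe U ⊆ X (as a family)

record Ops (X : Set) : Set₁ where
  field
    Ix : Set
    ar : Ix → ℕ
    op : (o : Ix) → Vec X (ar o) → X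
open Ops public

Rel : Set → ℕ → Set₁
Rel X n = Pred (Vec X n) 0ℓ

cw : ∀ {X : Set} {k n} → (Vec X k → X) → Vec (Vec X n) k → Vec X n
cw g rs = tabulate (λ p → g (map (λ r → lookup r p) rs))

IsCompatible : ∀ {X} (U : Pred X 0ℓ) (O : Ops X) {n} → Rel X n → Set
IsCompatible {X} U O {n} R =
  (∀ {t} → R t → ∀ j → U (lookup t j)) ×
  (∀ (o : Ix O) (rs : Vec (Vec X n) (ar O o)) →
     (∀ j → R (lookup rs j)) → R (cw (op O o) rs))

IsReflexive : ∀ {X} (U : Pred X 0ℓ) {n} → Rel X n → Set
IsReflexive U {n} R = ∀ {x} → U x → R (replicate n x)

-- compatible relation generated by R (lattice join = Gen (R ∪ S))
data Gen {X : Set} (O : Ops X) {n} (R : Rel X n) : Vec X n → Set where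
  base : ∀ {t} → R t → Gen O R t
  app  : (o : Ix O) (rs : Vec (Vec X n) (ar O o)) →
         (∀ j → Gen O R (lookup rs j)) → Gen O R (cw (op O o) rs)

_⨾_ : ∀ {X} → Rel X 2 → Rel X 2 → Rel X 2
_⨾_ {X} R S v = Σ X λ y → R (lookup v 0F ∷ y ∷ []) × S (y ∷ lookup v 1F ∷ [])

-- image under a coordinate map σ : [k] → [n]:
-- { (b_σ(1), …, b_σ(k)) : b ∈ R }  (permutation, duplication, projection)
img : ∀ {X} {k n} → (Fin k → Fin n) → Rel X n → Rel X k
img {X} {k} {n} σ R a = Σ (Vec X n) λ b → R b × (a ≡ tabulate (λ j → lookup b (σ j)))

-- preimage under a coordinate map τ : [n] → [k]:
-- { a : (a_τ(1), …, a_τ(n)) ∈ R }  (identification of coordinates when τ is onto)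
pre : ∀ {X} {k n} → (Fin n → Fin k) → Rel X n → Rel X k
pre τ R a = R (tabulate (λ j → lookup a (τ j)))

prod : ∀ {X} {k n} → Rel X k → Rel X n → Rel X (k + n)
prod {k = k} R S a = R (take k a) × S (drop k a)

module Construction (F : Signature) (nn : NoNullary F) (m : ℕ)
                    (I : FinAlgebraOps F m) (A : Algebra F)
                    (χ : Carrier A → Fin m) where

  Aₛ : Set
  Aₛ = Carrier A

  opsA : Ops Aₛ
  opsA = record { Ix = Op F ; ar = arity F ; op = ⟦ A ⟧ }

  UA : Pred Aₛ 0ℓ
  UA _ = ⊤

  Aα : (n : ℕ) → Rel Aₛ n
  Aα n b = ∀ j l → χ (lookup b j) ≡ χ (lookup b l)

  -- columns c = (c⁽¹⁾,…,c⁽ᵐ⁾) ∈ C = D⁽¹⁾ × … × D⁽ᵐ⁾, D⁽ⁱ⁾ = χ⁻¹(i)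
  Col : Set
  Col = Vec Aₛ m

  IsCol : Pred Col 0ℓ
  IsCol c = ∀ (i : Fin m) → χ (lookup c i) ≡ i

  dOp : Vec Col m → Col
  dOp cs = tabulate (λ i → lookup (lookup cs i) i)

  hatOp : (f : Op F) → Vec (Fin m) (arity F f) → Vec Col (arity F f) → Col
  hatOp f is cs =
    lookup cs (fromℕ< (nn f)) [ I f is ]≔
      ⟦ A ⟧ f (tabulate (λ j → lookup (lookup cs j) (lookup is j)))

  opsC : Ops Col
  opsC = record
    { Ix = ⊤ ⊎ Σ (Op F) (λ f → Vec (Fin m) (arity F f))
    ; ar = λ { (inj₁ _) → m ; (inj₂ (f , _)) → arity F f }
    ; op = λ { (inj₁ _) → dOp ; (inj₂ (f , is)) → hatOp f is }
    }

  RelA : (n : ℕ) → Rel Aₛ n → Set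
  RelA n B = IsReflexive UA B × IsCompatible UA opsA B × (B ⊆ Aα n)

  RelC : (n : ℕ) → Rel Col n → Set
  RelC n R = IsReflexive IsCol R × IsCompatible IsCol opsC R

  star : ∀ {n} → Rel Aₛ n → Rel Col n
  star B t = (∀ j → IsCol (lookup t j)) × (∀ (i : Fin m) → B (map (λ c → lookup c i) t))

  prodα : ∀ {k n} → Rel Aₛ k → Rel Aₛ n → Rel Aₛ (k + n)
  prodα {k} {n} R S = prod R S ∩ Aα (k + n)

  record LatticeIso (n : ℕ) : Set₁ where
    field
      into        : ∀ B → RelA n B → RelC n (star B)
      monotone    : ∀ B B' → RelA n B → RelA n B' → B ⊆ B' → star B ⊆ star B'
      reflecting  : ∀ B B' → RelA n B → RelA n B' → star B ⊆ star B' → B ⊆ B'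
      onto        : ∀ R → RelC n R → Σ (Rel Aₛ n) λ B → RelA n B × (star B ≐ R)
      pres-meet   : ∀ B B' → RelA n B → RelA n B' → star (B ∩ B') ≐ (star B ∩ star B')
      pres-join   : ∀ B B' → RelA n B → RelA n B' →
                    star (Gen opsA (B ∪ B')) ≐ Gen opsC (star B ∪ star B')

  record Preservation : Set₁ where
    field
      pres-∩    : ∀ {n} → 1 ≤ n → ∀ B B' → RelA n B → RelA n B' →
                  star (B ∩ B') ≐ (star B ∩ star B')
      pres-⨾    : ∀ R S → RelA 2 R → RelA 2 S → star (R ⨾ S) ≐ (star R ⨾ star S)
      pres-img  : ∀ {k n} → 1 ≤ k → 1 ≤ n → (σ : Fin k → Fin n) → ∀ B → RelA n B →
                  star (img σ B) ≐ img σ (star B)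
      pres-pre  : ∀ {k n} → 1 ≤ n → (τ : Fin n → Fin k) → IsSurjective τ → ∀ B → RelA n B →
                  star (pre τ B) ≐ pre τ (star B)
      pres-prod : ∀ {k n} → 1 ≤ k → 1 ≤ n → ∀ R S → RelA k R → RelA n S →
                  star (prodα R S) ≐ prod (star R) (star S)

-- Think of an n-tuple of elements of C as an m × n matrix over A whose columns
-- are the tuple entries; B* consists of the matrices all of whose rows lie in B.
-- The row i of f̂_𝐢 applied to tuples is f^A applied to the rows i₁, …, i_k of the
-- arguments when i = f^I(𝐢), and is row i of the first argument otherwise, while
-- row i of d(t₁,…,t_m) is row i of t_i.  Hence B* is compatible, and conversely a
-- compatible R is recovered from the set of its rows by d, so B ↦ B* is onto.
-- It reflects inclusion because b ∈ B ⊆ A^n[α] of colour i is row i of a matrix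
-- whose other rows are constant.  Joins are then preserved because B ↦ B* is an
-- order isomorphism, while meets and the relational operations act row by row.
module Submission where

open import Level using (0ℓ)
open import Defs
open import Data.Nat using (ℕ; _≤_; suc; _+_; s≤s; z≤n)
open import Data.Fin using (Fin; fromℕ<; _≟_)
open import Data.Fin.Patterns using (0F; 1F)
open import Data.Vec using (Vec; []; _∷_; lookup; tabulate; map; replicate; take; drop; _++_; _[_]≔_)
open import Data.Vec.Properties
  using (lookup-map; lookup∘tabulate; tabulate∘lookup; tabulate-cong; lookup∘update; lookup∘update′;
         map-replicate; lookup-replicate; take-map; drop-map; take++drop≡id)
open import Data.Vec.Relation.Unary.All using (All)
open import Data.Vec.Relation.Unary.All.Properties using (lookup⁺; lookup⁻; ++⁺; ++ˡ⁻; ++ʳ⁻)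
open import Data.Product using (Σ; _×_; _,_; proj₁; proj₂)
open import Data.Sum using (inj₁; inj₂)
open import Data.Unit using (tt)
open import Relation.Binary.PropositionalEquality
open import Relation.Nullary using (yes; no)
open import Relation.Unary using (Pred; _⊆_; _≐_; _∩_; _∪_)

lookup-extensionality : ∀ {X : Set} {n} {u v : Vec X n} → (∀ j → lookup u j ≡ lookup v j) → u ≡ v
lookup-extensionality {u = u} {v} h = begin
  u                  ≡⟨ tabulate∘lookup u ⟨
  tabulate (lookup u) ≡⟨ tabulate-cong h ⟩
  tabulate (lookup v) ≡⟨ tabulate∘lookup v ⟩
  v                  ∎
  where open ≡-Reasoning

select : ∀ {X : Set} {k n} → Fin n → Vec (Vec X n) k → Vec X k
select p vs = map (λ v → lookup v p) vs

lookup-select : ∀ {X : Set} {k n} (p : Fin n) (vs : Vec (Vec X n) k) j →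
                lookup (select p vs) j ≡ lookup (lookup vs j) p
lookup-select p vs j = lookup-map j (λ v → lookup v p) vs

select-ext : ∀ {X : Set} {k n} {t u : Vec (Vec X n) k} → (∀ p → select p t ≡ select p u) → t ≡ u
select-ext {t = t} {u} h = lookup-extensionality λ j → lookup-extensionality λ p →
  trans (sym (lookup-select p t j)) (trans (cong (λ v → lookup v j) (h p)) (lookup-select p u j))

lookup-cw : ∀ {X : Set} {k n} (g : Vec X k → X) (rs : Vec (Vec X n) k) p →
            lookup (cw g rs) p ≡ g (select p rs)
lookup-cw g rs p = lookup∘tabulate _ p

reindex : ∀ {X : Set} {k n} → (Fin k → Fin n) → Vec X n → Vec X k
reindex σ v = tabulate (λ j → lookup v (σ j))

select-reindex : ∀ {X : Set} {k n l} (σ : Fin k → Fin n) (p : Fin l) (t : Vec (Vec X l) n) →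
                 select p (reindex σ t) ≡ reindex σ (select p t)
select-reindex σ p t = lookup-extensionality λ j → begin
  lookup (select p (reindex σ t)) j   ≡⟨ lookup-select p (reindex σ t) j ⟩
  lookup (lookup (reindex σ t) j) p   ≡⟨ cong (λ v → lookup v p) (lookup∘tabulate _ j) ⟩
  lookup (lookup t (σ j)) p           ≡⟨ lookup-select p t (σ j) ⟨
  lookup (select p t) (σ j)           ≡⟨ lookup∘tabulate _ j ⟨
  lookup (reindex σ (select p t)) j   ∎
  where open ≡-Reasoning

pick : ∀ {X : Set} {k m} → Vec (Fin m) k → Vec (Vec X m) k → Vec X k
pick is cs = tabulate (λ j → lookup (lookup cs j) (lookup is j))

pick-select : ∀ {X : Set} {k n m} (is : Vec (Fin m) k) (rs : Vec (Vec (Vec X m) n) k) p →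
              pick is (select p rs) ≡ select p (tabulate (λ j → select (lookup is j) (lookup rs j)))
pick-select is rs p = lookup-extensionality λ j → begin
  lookup (pick is (select p rs)) j                  ≡⟨ lookup∘tabulate _ j ⟩
  lookup (lookup (select p rs) j) (lookup is j)     ≡⟨ cong (λ c → lookup c (lookup is j)) (lookup-select p rs j) ⟩
  lookup (lookup (lookup rs j) p) (lookup is j)     ≡⟨ lookup-select (lookup is j) (lookup rs j) p ⟨
  lookup (select (lookup is j) (lookup rs j)) p     ≡⟨ cong (λ v → lookup v p) (lookup∘tabulate _ j) ⟨
  lookup (lookup (tabulate rowsAt) j) p             ≡⟨ lookup-select p (tabulate rowsAt) j ⟨
  lookup (select p (tabulate rowsAt)) j             ∎
  where
  open ≡-Reasoning
  rowsAt = λ j → select (lookup is j) (lookup rs j)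

All-take-drop : ∀ {X : Set} k {n} (P : Pred X 0ℓ) (t : Vec X (k + n)) →
                (∀ j → P (lookup t j)) → (∀ j → P (lookup (take k t) j)) × (∀ j → P (lookup (drop k t) j))
All-take-drop k P t h = lookup⁺ (++ˡ⁻ (take k t) all) , lookup⁺ (++ʳ⁻ (take k t) all)
  where
  all : All P (take k t ++ drop k t)
  all = subst (All P) (sym (take++drop≡id k t)) (lookup⁻ h)

take-drop-All : ∀ {X : Set} k {n} (P : Pred X 0ℓ) (t : Vec X (k + n)) →
                (∀ j → P (lookup (take k t) j)) → (∀ j → P (lookup (drop k t) j)) → ∀ j → P (lookup t j)
take-drop-All k P t h₁ h₂ =
  lookup⁺ (subst (All P) (take++drop≡id k t) (++⁺ (lookup⁻ {xs = take k t} h₁) (lookup⁻ {xs = drop k t} h₂)))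

Closed : ∀ {X : Set} (O : Ops X) {n} → Rel X n → Set
Closed O {n} R = ∀ (o : Ix O) (rs : Vec (Vec _ n) (ar O o)) → (∀ j → R (lookup rs j)) → R (cw (op O o) rs)

Gen-least : ∀ {X : Set} (O : Ops X) {n} {R R′ : Rel X n} → Closed O R′ → R ⊆ R′ → Gen O R ⊆ R′
Gen-least O closed R⊆R′ (base r)     = R⊆R′ r
Gen-least O closed R⊆R′ (app o rs h) = closed o rs (λ j → Gen-least O closed R⊆R′ (h j))

module Matrices (F : Signature) (nn : NoNullary F) {m : ℕ} (I : FinAlgebraOps F m)
                (A : Algebra F) (χ : Carrier A → Fin m) where
  open Construction F nn m I A χ

  row : ∀ {n} → Fin m → Vec Col n → Vec Aₛ n
  row = select

  AllCol : ∀ {n} → Rel Col n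
  AllCol t = ∀ j → IsCol (lookup t j)

  χ-row : ∀ {n} (t : Vec Col n) → AllCol t → ∀ i j → χ (lookup (row i t) j) ≡ i
  χ-row t cs i j = trans (cong χ (lookup-select i t j)) (cs j i)

  row-∈-Aα : ∀ {n} (t : Vec Col n) → AllCol t → ∀ i → Aα n (row i t)
  row-∈-Aα t cs i j l = trans (χ-row t cs i j) (sym (χ-row t cs i l))

  lookup-row-cw : ∀ {k n} (g : Vec Col k → Col) (rs : Vec (Vec Col n) k) i p →
                  lookup (row i (cw g rs)) p ≡ lookup (g (select p rs)) i
  lookup-row-cw g rs i p = trans (lookup-select i (cw g rs) p) (cong (λ c → lookup c i) (lookup-cw g rs p))

  row-d : ∀ {n} (rs : Vec (Vec Col n) m) i → row i (cw dOp rs) ≡ row i (lookup rs i)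
  row-d rs i = lookup-extensionality λ p → begin
    lookup (row i (cw dOp rs)) p       ≡⟨ lookup-row-cw dOp rs i p ⟩
    lookup (dOp (select p rs)) i       ≡⟨ lookup∘tabulate _ i ⟩
    lookup (lookup (select p rs) i) i  ≡⟨ cong (λ c → lookup c i) (lookup-select p rs i) ⟩
    lookup (lookup (lookup rs i) p) i  ≡⟨ lookup-select i (lookup rs i) p ⟨
    lookup (row i (lookup rs i)) p     ∎
    where open ≡-Reasoning

  row-hat-target : ∀ {n} (f : Op F) (is : Vec (Fin m) (arity F f)) (rs : Vec (Vec Col n) (arity F f)) →
                   row (I f is) (cw (hatOp f is) rs)
                     ≡ cw (⟦ A ⟧ f) (tabulate (λ j → row (lookup is j) (lookup rs j)))
  row-hat-target f is rs = lookup-extensionality λ p → begin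
    lookup (row (I f is) (cw (hatOp f is) rs)) p  ≡⟨ lookup-row-cw (hatOp f is) rs (I f is) p ⟩
    lookup (hatOp f is (select p rs)) (I f is)    ≡⟨ lookup∘update (I f is) (lookup (select p rs) first) _ ⟩
    ⟦ A ⟧ f (pick is (select p rs))               ≡⟨ cong (⟦ A ⟧ f) (pick-select is rs p) ⟩
    ⟦ A ⟧ f (select p rows)                       ≡⟨ lookup-cw (⟦ A ⟧ f) rows p ⟨
    lookup (cw (⟦ A ⟧ f) rows) p                  ∎
    where
    open ≡-Reasoning
    first = fromℕ< (nn f)
    rows = tabulate (λ j → row (lookup is j) (lookup rs j))

  row-hat-other : ∀ {n} (f : Op F) (is : Vec (Fin m) (arity F f)) (rs : Vec (Vec Col n) (arity F f)) {i} →
                  i ≢ I f is → row i (cw (hatOp f is) rs) ≡ row i (lookup rs (fromℕ< (nn f)))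
  row-hat-other f is rs {i} i≢target = lookup-extensionality λ p → begin
    lookup (row i (cw (hatOp f is) rs)) p  ≡⟨ lookup-row-cw (hatOp f is) rs i p ⟩
    lookup (hatOp f is (select p rs)) i    ≡⟨ lookup∘update′ i≢target (lookup (select p rs) first) _ ⟩
    lookup (lookup (select p rs) first) i  ≡⟨ cong (λ c → lookup c i) (lookup-select p rs first) ⟩
    lookup (lookup (lookup rs first) p) i  ≡⟨ lookup-select i (lookup rs first) p ⟨
    lookup (row i (lookup rs first)) p     ∎
    where
    open ≡-Reasoning
    first = fromℕ< (nn f)

  star-∩ : ∀ {n} (B B′ : Rel Aₛ n) → star (B ∩ B′) ≐ (star B ∩ star B′)
  star-∩ B B′ = (λ (cs , r) → (cs , λ i → proj₁ (r i)) , (cs , λ i → proj₂ (r i)))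
              , (λ ((cs , r) , (_ , r′)) → cs , λ i → r i , r′ i)

  star-mono : ∀ {n} (B B′ : Rel Aₛ n) → B ⊆ B′ → star B ⊆ star B′
  star-mono _ _ B⊆B′ (cs , r) = cs , λ i → B⊆B′ (r i)

  AllCol-reindex : ∀ {k n} (σ : Fin k → Fin n) (t : Vec Col n) → AllCol t → AllCol (reindex σ t)
  AllCol-reindex σ t cs j = subst IsCol (sym (lookup∘tabulate (λ j → lookup t (σ j)) j)) (cs (σ j))

  AllCol-pair : ∀ {c c′} → IsCol c → IsCol c′ → AllCol (c ∷ c′ ∷ [])
  AllCol-pair cc cc′ 0F = cc
  AllCol-pair cc cc′ 1F = cc′

  fromRows : ∀ {n} → (Fin m → Vec Aₛ n) → Vec Col n
  fromRows b = tabulate (λ l → tabulate (λ i → lookup (b i) l))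

  row-fromRows : ∀ {n} (b : Fin m → Vec Aₛ n) i → row i (fromRows b) ≡ b i
  row-fromRows b i = lookup-extensionality λ l →
    trans (lookup-select i (fromRows b) l)
          (trans (cong (λ c → lookup c i) (lookup∘tabulate _ l)) (lookup∘tabulate _ i))

  AllCol-fromRows : ∀ {n} (b : Fin m → Vec Aₛ n) → (∀ i → Aα n (b i)) → ∀ l₀ →
                    (∀ i → χ (lookup (b i) l₀) ≡ i) → AllCol (fromRows b)
  AllCol-fromRows b bα l₀ colour l i = begin
    χ (lookup (lookup (fromRows b) l) i)  ≡⟨ cong χ (lookup-select i (fromRows b) l) ⟨
    χ (lookup (row i (fromRows b)) l)     ≡⟨ cong (λ v → χ (lookup v l)) (row-fromRows b i) ⟩
    χ (lookup (b i) l)                    ≡⟨ bα i l l₀ ⟩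
    χ (lookup (b i) l₀)                   ≡⟨ colour i ⟩
    i                                     ∎
    where open ≡-Reasoning

  rowsOf : ∀ {n} → Rel Col n → Rel Aₛ n
  rowsOf R b = Σ (Vec Col _) λ t → R t × Σ (Fin m) λ i → row i t ≡ b

  rowsOf-⊆-Aα : ∀ {n} (R : Rel Col n) → (∀ {t} → R t → AllCol t) → rowsOf R ⊆ Aα n
  rowsOf-⊆-Aα _ colR (t , rt , i , refl) = row-∈-Aα t (colR rt) i

  rowsOf-closed : ∀ {n} (R : Rel Col n) → Closed opsC R → Closed opsA (rowsOf R)
  rowsOf-closed R closedR f bs h =
    cw (hatOp f is) ts , closedR (inj₂ (f , is)) ts ts∈R , I f is , rowsEq
    where
    t  = λ j → proj₁ (h j)
    i  = λ j → proj₁ (proj₂ (proj₂ (h j)))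
    ts = tabulate t
    is = tabulate i
    ts∈R : ∀ j → R (lookup ts j)
    ts∈R j = subst R (sym (lookup∘tabulate t j)) (proj₁ (proj₂ (h j)))
    argRows : ∀ j → row (lookup is j) (lookup ts j) ≡ lookup bs j
    argRows j = trans (cong₂ row (lookup∘tabulate i j) (lookup∘tabulate t j)) (proj₂ (proj₂ (proj₂ (h j))))
    rowsEq : row (I f is) (cw (hatOp f is) ts) ≡ cw (⟦ A ⟧ f) bs
    rowsEq = trans (row-hat-target f is ts)
                   (cong (cw (⟦ A ⟧ f)) (lookup-extensionality λ j → trans (lookup∘tabulate _ j) (argRows j)))

  -- The colour of a row records its position.
  rowsOf-row : ∀ {n} (R : Rel Col (suc n)) → (∀ {t} → R t → AllCol t) → ∀ {u} i → AllCol u →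
               rowsOf R (row i u) → Σ (Vec Col (suc n)) λ t → R t × row i t ≡ row i u
  rowsOf-row R colR {u} i cu (t , rt , i′ , eq) with sameRow
    where
    sameRow : i′ ≡ i
    sameRow = trans (sym (χ-row t (colR rt) i′ 0F))
                    (trans (cong (λ b → χ (lookup b 0F)) eq) (χ-row u cu i 0F))
  ... | refl = t , rt , eq

  star-rowsOf⊆ : ∀ {n} (R : Rel Col (suc n)) → (∀ {t} → R t → AllCol t) → Closed opsC R →
                 star (rowsOf R) ⊆ R
  star-rowsOf⊆ R colR closedR {u} (cu , rows) = subst R fromD (closedR (inj₁ tt) ts ts∈R)
    where
    t = λ i → proj₁ (rowsOf-row R colR i cu (rows i))
    ts = tabulate t
    ts∈R : ∀ i → R (lookup ts i)
    ts∈R i = subst R (sym (lookup∘tabulate t i)) (proj₁ (proj₂ (rowsOf-row R colR i cu (rows i))))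
    fromD : cw dOp ts ≡ u
    fromD = select-ext λ i → begin
      row i (cw dOp ts)    ≡⟨ row-d ts i ⟩
      row i (lookup ts i)  ≡⟨ cong (row i) (lookup∘tabulate t i) ⟩
      row i (t i)          ≡⟨ proj₂ (proj₂ (rowsOf-row R colR i cu (rows i))) ⟩
      row i u              ∎
      where open ≡-Reasoning

  star-⨾⊇ : ∀ (R S : Rel Aₛ 2) → (star R ⨾ star S) ⊆ star (R ⨾ S)
  star-⨾⊇ R S {c ∷ c′ ∷ []} (y , (cs , r) , (cs′ , s)) =
    AllCol-pair (cs 0F) (cs′ 1F) , λ i → lookup y i , r i , s i

  star-⨾⊆ : ∀ (R S : Rel Aₛ 2) → R ⊆ Aα 2 → star (R ⨾ S) ⊆ (star R ⨾ star S)
  star-⨾⊆ R S Rα {c ∷ c′ ∷ []} (cs , h) =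
      y
    , (AllCol-pair (cs 0F) yCol , λ i → subst (λ z → R (lookup c i ∷ z ∷ [])) (sym (ly i)) (proj₁ (proj₂ (h i))))
    , (AllCol-pair yCol (cs 1F) , λ i → subst (λ z → S (z ∷ lookup c′ i ∷ [])) (sym (ly i)) (proj₂ (proj₂ (h i))))
    where
    y = tabulate (λ i → proj₁ (h i))
    ly : ∀ i → lookup y i ≡ proj₁ (h i)
    ly i = lookup∘tabulate _ i
    yCol : IsCol y
    yCol i = trans (cong χ (ly i)) (trans (Rα (proj₁ (proj₂ (h i))) 1F 0F) (cs 0F i))

  star-img⊇ : ∀ {k n} (σ : Fin k → Fin n) (B : Rel Aₛ n) → img σ (star B) ⊆ star (img σ B)
  star-img⊇ σ B (s , (cs , r) , refl) = AllCol-reindex σ s cs , λ i → row i s , r i , select-reindex σ i s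

  star-img⊆ : ∀ {k n} (σ : Fin (suc k) → Fin n) {B : Rel Aₛ n} → B ⊆ Aα n → star (img σ B) ⊆ img σ (star B)
  star-img⊆ σ {B} Bα {t} (cs , h) = s , (sCol , λ i → subst B (sym (row-fromRows b i)) (b∈B i)) , tEq
    where
    b = λ i → proj₁ (h i)
    b∈B = λ i → proj₁ (proj₂ (h i))
    s = fromRows b
    rowEq : ∀ i → row i t ≡ reindex σ (b i)
    rowEq i = proj₂ (proj₂ (h i))
    colour : ∀ i → χ (lookup (b i) (σ 0F)) ≡ i
    colour i = begin
      χ (lookup (b i) (σ 0F))              ≡⟨ cong χ (lookup∘tabulate (λ j → lookup (b i) (σ j)) 0F) ⟨
      χ (lookup (reindex σ (b i)) 0F)      ≡⟨ cong (λ v → χ (lookup v 0F)) (rowEq i) ⟨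
      χ (lookup (row i t) 0F)              ≡⟨ χ-row t cs i 0F ⟩
      i                                    ∎
      where open ≡-Reasoning
    sCol : AllCol s
    sCol = AllCol-fromRows b (λ i → Bα (b∈B i)) (σ 0F) colour
    tEq : t ≡ reindex σ s
    tEq = select-ext λ i → begin
      row i t                 ≡⟨ rowEq i ⟩
      reindex σ (b i)         ≡⟨ cong (reindex σ) (row-fromRows b i) ⟨
      reindex σ (row i s)     ≡⟨ select-reindex σ i s ⟨
      row i (reindex σ s)     ∎
      where open ≡-Reasoning

  star-pre : ∀ {k n} (τ : Fin n → Fin k) → IsSurjective τ → (B : Rel Aₛ n) → star (pre τ B) ≐ pre τ (star B)
  star-pre τ τ-onto B =
      (λ {t} (cs , r) → AllCol-reindex τ t cs , λ i → subst B (sym (select-reindex τ i t)) (r i))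
    , (λ {t} (cs , r) → allCol t cs , λ i → subst B (select-reindex τ i t) (r i))
    where
    allCol : ∀ t → AllCol (reindex τ t) → AllCol t
    allCol t cs l with τ-onto l
    ... | j , refl = subst IsCol (lookup∘tabulate (λ j → lookup t (τ j)) j) (cs j)

  star-prodα : ∀ {k n} (R : Rel Aₛ k) (S : Rel Aₛ n) → star (prodα R S) ≐ prod (star R) (star S)
  star-prodα {k} R S =
      (λ {t} (cs , r) → let (csR , csS) = All-take-drop k IsCol t cs in
          (csR , λ i → subst R (take-map (λ c → lookup c i) k t) (proj₁ (proj₁ (r i))))
        , (csS , λ i → subst S (drop-map (λ c → lookup c i) k t) (proj₂ (proj₁ (r i)))))
    , (λ {t} ((csR , r) , (csS , s)) → let cs = take-drop-All k IsCol t csR csS in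
          cs , λ i → ( subst R (sym (take-map (λ c → lookup c i) k t)) (r i)
                     , subst S (sym (drop-map (λ c → lookup c i) k t)) (s i))
                   , row-∈-Aα t cs i)

  module _ (hom : IsHom I A χ) where

    χ-pick : ∀ {k} (is : Vec (Fin m) k) (cs : Vec Col k) → AllCol cs → map χ (pick is cs) ≡ is
    χ-pick is cs h = lookup-extensionality λ j →
      trans (lookup-map j χ (pick is cs)) (trans (cong χ (lookup∘tabulate _ j)) (h j (lookup is j)))

    op-IsCol : ∀ o (cs : Vec Col (ar opsC o)) → AllCol cs → IsCol (op opsC o cs)
    op-IsCol (inj₁ tt) cs h i = trans (cong χ (lookup∘tabulate _ i)) (h i i)
    op-IsCol (inj₂ (f , is)) cs h = hat-IsCol (fromℕ< (nn f))
      where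
      hat-IsCol : ∀ first i → χ (lookup (lookup cs first [ I f is ]≔ ⟦ A ⟧ f (pick is cs)) i) ≡ i
      hat-IsCol first i with i ≟ I f is
      ... | yes refl = begin
        χ (lookup (lookup cs first [ i ]≔ ⟦ A ⟧ f (pick is cs)) i)  ≡⟨ cong χ (lookup∘update i (lookup cs first) _) ⟩
        χ (⟦ A ⟧ f (pick is cs))                                   ≡⟨ hom f (pick is cs) ⟩
        I f (map χ (pick is cs))                                   ≡⟨ cong (I f) (χ-pick is cs h) ⟩
        I f is                                                     ∎
        where open ≡-Reasoning
      ... | no i≢target = trans (cong χ (lookup∘update′ i≢target (lookup cs first) _)) (h first i)

    AllCol-closed : ∀ {n} → Closed opsC (AllCol {n})
    AllCol-closed o rs h p = subst IsCol (sym (lookup-cw (op opsC o) rs p))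
      (op-IsCol o (select p rs) (λ j → subst IsCol (sym (lookup-select p rs j)) (h j p)))

    star-closed : ∀ {n} (B : Rel Aₛ n) → Closed opsA B → Closed opsC (star B)
    star-closed B closedB o rs h = AllCol-closed o rs (λ j → proj₁ (h j)) , rowsIn B closedB o rs h
      where
      rowsIn : ∀ {n} (B : Rel Aₛ n) → Closed opsA B → ∀ o (rs : Vec (Vec Col n) (ar opsC o)) →
               (∀ j → star B (lookup rs j)) → ∀ i → B (row i (cw (op opsC o) rs))
      rowsIn B _ (inj₁ tt) rs h i = subst B (sym (row-d rs i)) (proj₂ (h i) i)
      rowsIn B closedB (inj₂ (f , is)) rs h i with i ≟ I f is
      ... | yes refl = subst B (sym (row-hat-target f is rs))
                         (closedB f _ λ j → subst B (sym (lookup∘tabulate _ j)) (proj₂ (h j) (lookup is j)))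
      ... | no i≢target = subst B (sym (row-hat-other f is rs i≢target)) (proj₂ (h (fromℕ< (nn f))) i)

    star-reflexive : ∀ {n} (B : Rel Aₛ n) → IsReflexive UA B → IsReflexive IsCol (star B)
    star-reflexive {n} B reflB {c} cc =
      (λ j → subst IsCol (sym (lookup-replicate j c)) cc) ,
      λ i → subst B (sym (map-replicate (λ c → lookup c i) c n)) (reflB tt)

    star-RelC : ∀ {n} (B : Rel Aₛ n) → RelA n B → RelC n (star B)
    star-RelC B (reflB , (_ , closedB) , _) = star-reflexive B reflB , proj₁ , star-closed B closedB

    Gen-RelC : ∀ {n} (R R′ : Rel Col n) → RelC n R → RelC n R′ → RelC n (Gen opsC (R ∪ R′))
    Gen-RelC _ _ (reflR , (colR , _)) (_ , (colR′ , _)) =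
        (λ cc → base (inj₁ (reflR cc)))
      , Gen-least opsC AllCol-closed (λ { (inj₁ r) → colR r ; (inj₂ r′) → colR′ r′ })
      , app

    module _ (surj : IsSurjective χ) where

      representatives : Col
      representatives = tabulate (λ p → proj₁ (surj p))

      columnThrough : Fin m → Aₛ → Col
      columnThrough i x = representatives [ i ]≔ x

      columnThrough-IsCol : ∀ {i} x → χ x ≡ i → IsCol (columnThrough i x)
      columnThrough-IsCol {i} x χx≡i p with p ≟ i
      ... | yes refl = trans (cong χ (lookup∘update i representatives x)) χx≡i
      ... | no p≢i   = begin
        χ (lookup (representatives [ i ]≔ x) p)  ≡⟨ cong χ (lookup∘update′ p≢i representatives x) ⟩
        χ (lookup representatives p)             ≡⟨ cong χ (lookup∘tabulate _ p) ⟩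
        χ (proj₁ (surj p))                       ≡⟨ proj₂ (surj p) ⟩
        p                                        ∎
        where open ≡-Reasoning

      rowsOf-reflexive : ∀ {n} (R : Rel Col n) → IsReflexive IsCol R → IsReflexive UA (rowsOf R)
      rowsOf-reflexive {n} _ reflR {x} _ =
        replicate n c , reflR (columnThrough-IsCol x refl) , χ x ,
        trans (map-replicate (λ c → lookup c (χ x)) c n)
              (cong (replicate n) (lookup∘update (χ x) representatives x))
        where
        c = columnThrough (χ x) x

      rowsOf-RelA : ∀ {n} (R : Rel Col n) → RelC n R → RelA n (rowsOf R)
      rowsOf-RelA R (reflR , (colR , closedR)) =
        rowsOf-reflexive R reflR , ((λ _ _ → tt) , rowsOf-closed R closedR) , rowsOf-⊆-Aα R colR

      star-rowsOf : ∀ {n} (R : Rel Col (suc n)) → RelC (suc n) R → star (rowsOf R) ≐ R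
      star-rowsOf R (_ , (colR , closedR)) =
        star-rowsOf⊆ R colR closedR , λ {t} rt → colR rt , λ i → t , rt , i , refl

      columnsThrough : ∀ {n} → Fin m → Vec Aₛ n → Vec Col n
      columnsThrough i b = tabulate (λ j → columnThrough i (lookup b j))

      lookup-row-columnsThrough : ∀ {n} p i (b : Vec Aₛ n) j →
                                  lookup (row p (columnsThrough i b)) j ≡ lookup (columnThrough i (lookup b j)) p
      lookup-row-columnsThrough p i b j =
        trans (lookup-select p (columnsThrough i b) j) (cong (λ c → lookup c p) (lookup∘tabulate _ j))

      row-columnsThrough-self : ∀ {n} i (b : Vec Aₛ n) → row i (columnsThrough i b) ≡ b
      row-columnsThrough-self i b = lookup-extensionality λ j →
        trans (lookup-row-columnsThrough i i b j) (lookup∘update i representatives (lookup b j))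

      row-columnsThrough-other : ∀ {n} {p i} (b : Vec Aₛ n) → p ≢ i →
                                 row p (columnsThrough i b) ≡ replicate n (lookup representatives p)
      row-columnsThrough-other {p = p} {i} b p≢i = lookup-extensionality λ j → begin
        lookup (row p (columnsThrough i b)) j        ≡⟨ lookup-row-columnsThrough p i b j ⟩
        lookup (representatives [ i ]≔ lookup b j) p ≡⟨ lookup∘update′ p≢i representatives (lookup b j) ⟩
        lookup representatives p                     ≡⟨ lookup-replicate j _ ⟨
        lookup (replicate _ (lookup representatives p)) j ∎
        where open ≡-Reasoning

      star-columnsThrough : ∀ {n} (B : Rel Aₛ n) → IsReflexive UA B → ∀ {i b} → B b →
                            (∀ j → χ (lookup b j) ≡ i) → star B (columnsThrough i b)
      star-columnsThrough B reflB {i} {b} b∈B colour =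
        (λ j → subst IsCol (sym (lookup∘tabulate _ j)) (columnThrough-IsCol (lookup b j) (colour j))) , rows
        where
        rows : ∀ p → B (row p (columnsThrough i b))
        rows p with p ≟ i
        ... | yes refl = subst B (sym (row-columnsThrough-self i b)) b∈B
        ... | no p≢i   = subst B (sym (row-columnsThrough-other b p≢i)) (reflB tt)

      star-reflects : ∀ {n} (B B′ : Rel Aₛ (suc n)) → RelA (suc n) B → star B ⊆ star B′ → B ⊆ B′
      star-reflects B B′ (reflB , _ , Bα) star⊆ {b} b∈B =
        subst B′ (row-columnsThrough-self i b) (proj₂ (star⊆ b∈B*) i)
        where
        i = χ (lookup b 0F)
        b∈B* : star B (columnsThrough i b)
        b∈B* = star-columnsThrough B reflB b∈B λ j → Bα b∈B j 0F

      star-Gen : ∀ {n} (B B′ : Rel Aₛ (suc n)) → RelA (suc n) B → RelA (suc n) B′ →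
                 star (Gen opsA (B ∪ B′)) ≐ Gen opsC (star B ∪ star B′)
      star-Gen B B′ hB hB′ = star⊆ , Gen-least opsC (star-closed (Gen opsA (B ∪ B′)) app) starB∪B′⊆
        where
        GC = Gen opsC (star B ∪ star B′)
        hGC = Gen-RelC (star B) (star B′) (star-RelC B hB) (star-RelC B′ hB′)
        B∪B′⊆rows : (B ∪ B′) ⊆ rowsOf GC
        B∪B′⊆rows (inj₁ b) = star-reflects B  (rowsOf GC) hB  (λ s → proj₂ (star-rowsOf GC hGC) (base (inj₁ s))) b
        B∪B′⊆rows (inj₂ b) = star-reflects B′ (rowsOf GC) hB′ (λ s → proj₂ (star-rowsOf GC hGC) (base (inj₂ s))) b
        star⊆ : star (Gen opsA (B ∪ B′)) ⊆ GC
        star⊆ s = proj₁ (star-rowsOf GC hGC)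
          (star-mono _ (rowsOf GC) (Gen-least opsA (rowsOf-closed GC (proj₂ (proj₂ hGC))) B∪B′⊆rows) s)
        starB∪B′⊆ : (star B ∪ star B′) ⊆ star (Gen opsA (B ∪ B′))
        starB∪B′⊆ (inj₁ s) = star-mono B _ (λ b → base (inj₁ b)) s
        starB∪B′⊆ (inj₂ s) = star-mono B′ _ (λ b → base (inj₂ b)) s

      latticeIso : ∀ n → LatticeIso (suc n)
      latticeIso n = record
        { into       = star-RelC
        ; monotone   = λ B B′ _ _ → star-mono B B′
        ; reflecting = λ B B′ hB _ → star-reflects B B′ hB
        ; onto       = λ R hR → rowsOf R , rowsOf-RelA R hR , star-rowsOf R hR
        ; pres-meet  = λ B B′ _ _ → star-∩ B B′
        ; pres-join  = star-Gen
        }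

  preservation : Preservation
  preservation = record
    { pres-∩    = λ _ B B′ _ _ → star-∩ B B′
    ; pres-⨾    = λ R S (_ , _ , Rα) _ → (λ {t} → star-⨾⊆ R S Rα {t}) , (λ {t} → star-⨾⊇ R S {t})
    ; pres-img  = λ { (s≤s z≤n) _ σ B (_ , _ , Bα) → star-img⊆ σ Bα , star-img⊇ σ B }
    ; pres-pre  = λ _ τ τ-onto B _ → star-pre τ τ-onto B
    ; pres-prod = λ _ _ R S _ _ → star-prodα R S
    }

corollary3p2 : (F : Signature) (nn : NoNullary F) (m : ℕ) (I : FinAlgebraOps F m)
               (A : Algebra F) (χ : Carrier A → Fin m) →
               IsHom I A χ → IsSurjective χ →
               ((n : ℕ) → 1 ≤ n → Construction.LatticeIso F nn m I A χ n)
               × Construction.Preservation F nn m I A χ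
corollary3p2 F nn m I A χ hom surj = (λ { (suc n) (s≤s z≤n) → latticeIso hom surj n }) , preservation
  where open Matrices F nn I A χ
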